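{- Let $G$ be a connected graph with a vertex $v$ such that $\deg_G(v)\ge 3$, $N_G(v)$ is an independent set, every vertex in $N_G(v)$ has degree at least two, and $G-N_G[v]$ is connected. Then $G\notin\mathcal{G}^{\mathrm{cs}}$.
   Context: All graphs are finite and simple; $N_G(v)$ is the neighborhood and $N_G[v]=N_G(v)\cup\{v\}$. A weight function on $V(G)$ is a map $w:V(G)\to\mathbb{R}_{>0}$; for $X\subseteq V(G)$ put $w(X)=\sum_{v\in X}w(v)$. A non-empty set $S\subseteq V(G)$ is a weighted safe set of $(G,w)$ if for every component $C$ of the induced subgraph $G[S]$ and every component $D$ of $G-S$ such that some edge joins $C$ and $D$, we have $w(C)\ge w(D)$. It is a connected weighted safe set if moreover $G[S]$ is connected. $\mathrm{s}(G,w)$ (resp. $\mathrm{cs}(G,w)$) is the minimum of $w(S)$ over all weighted safe sets (resp. connected weighted safe sets) $S$ of $(G,w)$. $\mathcal{G}^{\mathrm{cs}}$ denotes the family of all graphs $G$ such that $\mathrm{s}(G,w)=\mathrm{cs}(G,w)$ for every weight function $w$ on $V(G)$. -}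

module Defs where

open import Data.Nat using (ℕ; _≤_)
open import Data.Bool using (Bool; true; false; if_then_else_)
open import Data.Fin using (Fin)
open import Data.Fin.Subset using (Subset; _∈_; _∉_; _⊆_; ∁; ∣_∣; Nonempty)
open import Data.Vec using (tabulate)
open import Data.Vec.Functional using (foldr)
open import Data.Product using (Σ; ∃; _×_; _,_)
open import Data.Empty using (⊥)
open import Relation.Nullary using (¬_)
open import Relation.Binary.PropositionalEquality using (_≡_)
open import Function.Bundles using (_⇔_)
import Data.Rational as ℚ
open ℚ using (ℚ; 0ℚ)

record Graph (n : ℕ) : Set where
  field
    adj     : Fin n → Fin n → Bool
    sym     : ∀ u v → adj u v ≡ adj v u
    irrefl  : ∀ u → adj u u ≡ false

open Graph public

Adj : ∀ {n} → Graph n → Fin n → Fin n → Set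
Adj G u v = adj G u v ≡ true

N : ∀ {n} → Graph n → Fin n → Subset n
N G v = tabulate (adj G v)

N[_] : ∀ {n} → Graph n → Fin n → Subset n
N[ G ] v = tabulate (λ u → adj G v u Data.Bool.∨ isv u)
  where
  open import Data.Fin using (_≟_)
  open import Relation.Nullary.Decidable using (⌊_⌋)
  isv : _ → Bool
  isv u = ⌊ u ≟ v ⌋

deg : ∀ {n} → Graph n → Fin n → ℕ
deg G v = ∣ N G v ∣

data Reach {n} (G : Graph n) (X : Subset n) (u : Fin n) : Fin n → Set where
  here : u ∈ X → Reach G X u u
  step : ∀ {w x} → Reach G X u w → Adj G w x → x ∈ X → Reach G X u x

ConnectedOn : ∀ {n} → Graph n → Subset n → Set
ConnectedOn G X = ∀ u v → u ∈ X → v ∈ X → Reach G X u v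

Connected : ∀ {n} → Graph n → Set
Connected G = ConnectedOn G Data.Fin.Subset.⊤

IsComponent : ∀ {n} → Graph n → Subset n → Subset n → Set
IsComponent G X C = Σ _ λ u → u ∈ X × (∀ v → (v ∈ C) ⇔ Reach G X u v)

Independent : ∀ {n} → Graph n → Subset n → Set
Independent G I = ∀ x y → x ∈ I → y ∈ I → ¬ Adj G x y

EdgeBetween : ∀ {n} → Graph n → Subset n → Subset n → Set
EdgeBetween G C D = ∃ λ x → ∃ λ y → x ∈ C × y ∈ D × Adj G x y

Weight : ℕ → Set
Weight n = Fin n → ℚ

Positive : ∀ {n} → Weight n → Set
Positive w = ∀ v → 0ℚ ℚ.< w v

wsum : ∀ {n} → Weight n → Subset n → ℚ
wsum w X = foldr ℚ._+_ 0ℚ (λ i → if Data.Vec.lookup X i then w i else 0ℚ)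

IsSafe : ∀ {n} → Graph n → Weight n → Subset n → Set
IsSafe G w S = Nonempty S ×
  (∀ C D → IsComponent G S C → IsComponent G (∁ S) D →
     EdgeBetween G C D → wsum w D ℚ.≤ wsum w C)

IsConnSafe : ∀ {n} → Graph n → Weight n → Subset n → Set
IsConnSafe G w S = IsSafe G w S × ConnectedOn G S

IsMinOver : ∀ {n} → Weight n → (Subset n → Set) → ℚ → Set
IsMinOver w P m = (∃ λ S → P S × wsum w S ≡ m) × (∀ S → P S → m ℚ.≤ wsum w S)

IsSafeNumber : ∀ {n} → Graph n → Weight n → ℚ → Set
IsSafeNumber G w = IsMinOver w (IsSafe G w)

IsConnSafeNumber : ∀ {n} → Graph n → Weight n → ℚ → Set
IsConnSafeNumber G w = IsMinOver w (IsConnSafe G w)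

InGcs : ∀ {n} → Graph n → Set
InGcs G = ∀ (w : Weight _) → Positive w →
  ∀ a b → IsSafeNumber G w a → IsConnSafeNumber G w b → a ≡ b

-- Let H = V(G) − N[v] and M = |H|, and give every vertex of N[v] weight M and
-- every vertex of H weight 1. The set S₀ = V(G) − N(v) is a safe set of weight
-- 2M: since N(v) is independent, the components of G − S₀ are single
-- neighbours of v (weight M), and a component of G[S₀] next to one of them
-- contains v or, H being connected, all of H. Conversely, three distinct
-- vertices two of which lie in N[v] weigh more than 2M, and a connected safe
-- set S of weight at most 2M always produces such a triple, either inside S or
-- inside a component of G − S adjacent to S (which weighs at most w(S)):
-- look at whether v ∈ S and at which of three neighbours of v lie in S.
-- Hence s(G,w) ≤ 2M < cs(G,w). The minima exist only classically, which is
-- harmless as the claim is a negation: the argument runs under ¬ ¬.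
module Submission where

open import Defs hiding (sym)
open import Data.Nat using (ℕ; zero; suc; _+_; _≤_; _<_; z≤n; s≤s)
import Data.Nat.Properties as ℕ
open import Data.Bool using (Bool; true; false; _∨_)
open import Data.Fin using (Fin; zero; suc; _≟_)
open import Data.Fin.Subset using (Subset; _∈_; _∉_; _⊆_; ∁; ⊤; ⁅_⁆; _─_; _-_; ∣_∣; Nonempty; inside; outside)
open import Data.Fin.Subset.Properties using (_∈?_; drop-∷-⊆; ∈⊤; p─⊥≡p; p─q⊆p; x∈p∧x≢y⇒x∈p-y; x∈⁅x⁆; x∈∁p⇒x∉p; x∉p⇒x∈∁p; x∉∁p⇒x∈p)
import Data.Fin.Subset as Subset
open import Data.Vec using ([]; _∷_; tabulate; here; there)
open import Data.Vec.Properties using (lookup∘tabulate; []=⇒lookup; lookup⇒[]=)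
open import Data.Product using (∃; ∃₂; _×_; _,_; proj₁)
open import Data.Sum using (_⊎_; inj₁; inj₂; [_,_]′)
open import Data.Empty using (⊥)
open import Function using (_∘_; case_of_)
open import Function.Bundles using (_⇔_; mk⇔; Equivalence)
open Equivalence using (to; from)
open import Function.Construct.Composition using (_⇔-∘_)
open import Relation.Nullary using (¬_; Dec; yes; no; contradiction)
open import Relation.Nullary.Decidable using (⌊_⌋; decidable-stable)
open import Relation.Nullary.Negation using (¬¬-Monad)
open import Relation.Nullary.Decidable.Core using (¬¬-excluded-middle)
open import Relation.Binary.PropositionalEquality using (_≡_; _≢_; refl; sym; trans; cong; cong₂; subst; subst₂; module ≡-Reasoning)
open import Effect.Monad using (RawMonad)
open import Level using (0ℓ)
open import Algebra.Properties.CommutativeSemigroup ℕ.+-commutativeSemigroup using (x∙yz≈y∙xz)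
import Data.Rational as ℚ
import Data.Rational.Properties as ℚₚ
import Data.Rational.Unnormalised as ℚᵘ
import Data.Rational.Unnormalised.Properties as ℚᵘₚ
open ℚ using (ℚ; 0ℚ; mkℚ)
import Data.Integer as ℤ
import Data.Integer.Properties as ℤₚ
open import Data.Nat.Coprimality using (1-coprimeTo)
import Data.Nat.Coprimality as Coprime

open RawMonad (¬¬-Monad {0ℓ}) using (_>>=_; pure)

fromℕ : ℕ → ℚ
fromℕ m = mkℚ (ℤ.+ m) 0 (Coprime.sym (1-coprimeTo m))

fromℕ-+ : ∀ m k → fromℕ m ℚ.+ fromℕ k ≡ fromℕ (m + k)
fromℕ-+ m k = ℚₚ.toℚᵘ-injective (ℚᵘₚ.≃-trans (ℚₚ.toℚᵘ-homo-+ (fromℕ m) (fromℕ k)) (ℚᵘ.*≡* cross))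
  where
  cross : (ℤ.+ m ℤ.* ℤ.+ 1 ℤ.+ ℤ.+ k ℤ.* ℤ.+ 1) ℤ.* ℤ.+ 1 ≡ ℤ.+ (m + k) ℤ.* ℤ.+ 1
  cross rewrite ℤₚ.*-identityʳ (ℤ.+ m) | ℤₚ.*-identityʳ (ℤ.+ k) | ℤₚ.*-identityʳ (ℤ.+ m ℤ.+ ℤ.+ k)
    = sym (ℤₚ.pos-+ m k)

fromℕ-mono-≤ : ∀ {m k} → m ≤ k → fromℕ m ℚ.≤ fromℕ k
fromℕ-mono-≤ {m} {k} m≤k =
  ℚ.*≤* (subst₂ ℤ._≤_ (sym (ℤₚ.*-identityʳ (ℤ.+ m))) (sym (ℤₚ.*-identityʳ (ℤ.+ k))) (ℤ.+≤+ m≤k))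

fromℕ-cancel-≤ : ∀ {m k} → fromℕ m ℚ.≤ fromℕ k → m ≤ k
fromℕ-cancel-≤ {m} {k} (ℚ.*≤* le)
  with subst₂ ℤ._≤_ (ℤₚ.*-identityʳ (ℤ.+ m)) (ℤₚ.*-identityʳ (ℤ.+ k)) le
... | ℤ.+≤+ m≤k = m≤k

fromℕ-mono-< : ∀ {m k} → m < k → fromℕ m ℚ.< fromℕ k
fromℕ-mono-< {m} {k} m<k =
  ℚ.*<* (subst₂ ℤ._<_ (sym (ℤₚ.*-identityʳ (ℤ.+ m))) (sym (ℤₚ.*-identityʳ (ℤ.+ k))) (ℤ.+<+ m<k))

fromℕ-positive : ∀ {m} → 1 ≤ m → 0ℚ ℚ.< fromℕ m
fromℕ-positive {m} 1≤m = ℚ.*<* (subst (ℤ.+ 0 ℤ.<_) (sym (ℤₚ.*-identityʳ (ℤ.+ m))) (ℤ.+<+ 1≤m))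

wsumℕ : ∀ {n} → (Fin n → ℕ) → Subset n → ℕ
wsumℕ f []            = 0
wsumℕ f (inside ∷ X)  = f zero + wsumℕ (f ∘ suc) X
wsumℕ f (outside ∷ X) = wsumℕ (f ∘ suc) X

wsum-fromℕ : ∀ {n} (f : Fin n → ℕ) X → wsum (fromℕ ∘ f) X ≡ fromℕ (wsumℕ f X)
wsum-fromℕ f []            = refl
wsum-fromℕ f (inside ∷ X)  =
  trans (cong (fromℕ (f zero) ℚ.+_) (wsum-fromℕ (f ∘ suc) X)) (fromℕ-+ (f zero) _)
wsum-fromℕ f (outside ∷ X) =
  trans (cong (0ℚ ℚ.+_) (wsum-fromℕ (f ∘ suc) X)) (fromℕ-+ 0 _)

wsumℕ-mono : ∀ {n} (f : Fin n → ℕ) {X Y} → X ⊆ Y → wsumℕ f X ≤ wsumℕ f Y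
wsumℕ-mono f {[]}          {[]}          _   = z≤n
wsumℕ-mono f {inside ∷ X}  {inside ∷ Y}  X⊆Y = ℕ.+-monoʳ-≤ (f zero) (wsumℕ-mono (f ∘ suc) (drop-∷-⊆ X⊆Y))
wsumℕ-mono f {inside ∷ X}  {outside ∷ Y} X⊆Y = contradiction (X⊆Y here) λ ()
wsumℕ-mono f {outside ∷ X} {inside ∷ Y}  X⊆Y =
  ℕ.≤-trans (wsumℕ-mono (f ∘ suc) (drop-∷-⊆ X⊆Y)) (ℕ.m≤n+m _ (f zero))
wsumℕ-mono f {outside ∷ X} {outside ∷ Y} X⊆Y = wsumℕ-mono (f ∘ suc) (drop-∷-⊆ X⊆Y)

wsumℕ-⊥ : ∀ {n} (f : Fin n → ℕ) → wsumℕ f Subset.⊥ ≡ 0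
wsumℕ-⊥ {zero}  f = refl
wsumℕ-⊥ {suc n} f = wsumℕ-⊥ (f ∘ suc)

wsumℕ-⁅⁆ : ∀ {n} (f : Fin n → ℕ) i → wsumℕ f ⁅ i ⁆ ≡ f i
wsumℕ-⁅⁆ f zero    = trans (cong (f zero +_) (wsumℕ-⊥ (f ∘ suc))) (ℕ.+-identityʳ (f zero))
wsumℕ-⁅⁆ f (suc i) = wsumℕ-⁅⁆ (f ∘ suc) i

wsumℕ-∈ : ∀ {n} (f : Fin n → ℕ) {X i} → i ∈ X → wsumℕ f X ≡ f i + wsumℕ f (X - i)
wsumℕ-∈ f {inside ∷ X}  {zero}  here      = cong (λ Y → f zero + wsumℕ (f ∘ suc) Y) (sym (p─⊥≡p X))
wsumℕ-∈ f {inside ∷ X}  {suc i} (there i∈X) = begin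
  f zero + wsumℕ (f ∘ suc) X                        ≡⟨ cong (f zero +_) (wsumℕ-∈ (f ∘ suc) i∈X) ⟩
  f zero + (f (suc i) + wsumℕ (f ∘ suc) (X - i))    ≡⟨ x∙yz≈y∙xz (f zero) (f (suc i)) _ ⟩
  f (suc i) + (f zero + wsumℕ (f ∘ suc) (X - i))    ∎
  where open ≡-Reasoning
wsumℕ-∈ f {outside ∷ X} {suc i} (there i∈X) = wsumℕ-∈ (f ∘ suc) i∈X

wsumℕ-ones : ∀ {n} (f : Fin n → ℕ) {X} → (∀ {i} → i ∈ X → f i ≡ 1) → wsumℕ f X ≡ ∣ X ∣
wsumℕ-ones f {[]}          _    = refl
wsumℕ-ones f {inside ∷ X}  ones = cong₂ _+_ (ones here) (wsumℕ-ones (f ∘ suc) (ones ∘ there))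
wsumℕ-ones f {outside ∷ X} ones = wsumℕ-ones (f ∘ suc) (ones ∘ there)

wsumℕ-≥-single : ∀ {n} (f : Fin n → ℕ) {X i} → i ∈ X → f i ≤ wsumℕ f X
wsumℕ-≥-single f i∈X = subst (f _ ≤_) (sym (wsumℕ-∈ f i∈X)) (ℕ.m≤m+n _ _)

wsumℕ-≥-triple : ∀ {n} (f : Fin n → ℕ) {X x y z} → x ∈ X → y ∈ X → z ∈ X →
  x ≢ y → x ≢ z → y ≢ z → f x + f y + f z ≤ wsumℕ f X
wsumℕ-≥-triple f {X} {x} {y} {z} x∈X y∈X z∈X x≢y x≢z y≢z = begin
  f x + f y + f z                          ≡⟨ ℕ.+-assoc (f x) (f y) (f z) ⟩
  f x + (f y + f z)                        ≤⟨ ℕ.+-monoʳ-≤ (f x) (ℕ.+-monoʳ-≤ (f y) (wsumℕ-≥-single f z∈X-x-y)) ⟩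
  f x + (f y + wsumℕ f (X - x - y))        ≡⟨ cong (f x +_) (wsumℕ-∈ f y∈X-x) ⟨
  f x + wsumℕ f (X - x)                    ≡⟨ wsumℕ-∈ f x∈X ⟨
  wsumℕ f X                                ∎
  where
  open ℕ.≤-Reasoning
  y∈X-x : y ∈ X - x
  y∈X-x = x∈p∧x≢y⇒x∈p-y y∈X (x≢y ∘ sym)
  z∈X-x-y : z ∈ X - x - y
  z∈X-x-y = x∈p∧x≢y⇒x∈p-y (x∈p∧x≢y⇒x∈p-y z∈X (x≢z ∘ sym)) (y≢z ∘ sym)

x∈p⇒∣p∣≡suc∣p-x∣ : ∀ {n} {p : Subset n} {x} → x ∈ p → ∣ p ∣ ≡ suc ∣ p - x ∣
x∈p⇒∣p∣≡suc∣p-x∣ {p = p} {x} x∈p = begin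
  ∣ p ∣                           ≡⟨ wsumℕ-ones one {p} (λ _ → refl) ⟨
  wsumℕ one p                     ≡⟨ wsumℕ-∈ one x∈p ⟩
  suc (wsumℕ one (p - x))         ≡⟨ cong suc (wsumℕ-ones one {p - x} (λ _ → refl)) ⟩
  suc ∣ p - x ∣                   ∎
  where
  open ≡-Reasoning
  one : Fin _ → ℕ
  one _ = 1

∣p∣>0⇒nonempty : ∀ {n} (p : Subset n) → 0 < ∣ p ∣ → Nonempty p
∣p∣>0⇒nonempty (inside ∷ p)  _     = zero , here
∣p∣>0⇒nonempty (outside ∷ p) 1≤∣p∣ with ∣p∣>0⇒nonempty p 1≤∣p∣
... | x , x∈p = suc x , there x∈p

x∈p─q⇒x∉q : ∀ {n} (p q : Subset n) {x} → x ∈ p ─ q → x ∉ q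
x∈p─q⇒x∉q (inside ∷ p)  (outside ∷ q) here       ()
x∈p─q⇒x∉q (_ ∷ p)       (_ ∷ q)       (there x∈) (there x∈q) = x∈p─q⇒x∉q p q x∈ x∈q

x∈p-y⇒x≢y : ∀ {n} {p : Subset n} {x y} → x ∈ p - y → x ≢ y
x∈p-y⇒x≢y {p = p} {y = y} x∈ refl = x∈p─q⇒x∉q p ⁅ y ⁆ x∈ (x∈⁅x⁆ y)

pick : ∀ {n k} {p : Subset n} → suc k ≤ ∣ p ∣ → ∃ λ x → x ∈ p × k ≤ ∣ p - x ∣
pick {p = p} k<∣p∣ with ∣p∣>0⇒nonempty p (ℕ.≤-trans (s≤s z≤n) k<∣p∣)
... | x , x∈p = x , x∈p , ℕ.≤-pred (subst (_ ≤_) (x∈p⇒∣p∣≡suc∣p-x∣ x∈p) k<∣p∣)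

∃-∈-≢ : ∀ {n} {p : Subset n} → 2 ≤ ∣ p ∣ → ∀ y → ∃ λ x → x ∈ p × x ≢ y
∃-∈-≢ {p = p} 2≤∣p∣ y with pick 2≤∣p∣
... | x , x∈p , 1≤∣p-x∣ with ∣p∣>0⇒nonempty (p - x) 1≤∣p-x∣ | x ≟ y
...   | x′ , x′∈p-x | yes refl = x′ , p─q⊆p p ⁅ x ⁆ x′∈p-x , x∈p-y⇒x≢y x′∈p-x
...   | _           | no x≢y   = x , x∈p , x≢y

distinct-triple : ∀ {n} {p : Subset n} → 3 ≤ ∣ p ∣ →
  ∃ λ x → ∃₂ λ y z → x ∈ p × y ∈ p × z ∈ p × x ≢ y × x ≢ z × y ≢ z
distinct-triple {p = p} 3≤∣p∣ with pick 3≤∣p∣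
... | x , x∈p , 2≤∣p-x∣ with pick 2≤∣p-x∣
...   | y , y∈p-x , 1≤∣p-x-y∣ with ∣p∣>0⇒nonempty (p - x - y) 1≤∣p-x-y∣
...     | z , z∈p-x-y =
  let z∈p-x = p─q⊆p (p - x) ⁅ y ⁆ z∈p-x-y in
  x , y , z , x∈p , p─q⊆p p ⁅ x ⁆ y∈p-x , p─q⊆p p ⁅ x ⁆ z∈p-x ,
  (x∈p-y⇒x≢y y∈p-x ∘ sym) , (x∈p-y⇒x≢y z∈p-x ∘ sym) , (x∈p-y⇒x≢y z∈p-x-y ∘ sym)

two-avoiding : ∀ {n} {p : Subset n} {x y z} → x ∈ p → y ∈ p → z ∈ p → x ≢ y → x ≢ z → y ≢ z →
  ∀ u → ∃₂ λ a b → a ∈ p × b ∈ p × a ≢ b × a ≢ u × b ≢ u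
two-avoiding {x = x} {y} x∈p y∈p z∈p x≢y x≢z y≢z u with x ≟ u | y ≟ u
... | yes refl | _        = _ , _ , y∈p , z∈p , y≢z , (x≢y ∘ sym) , (x≢z ∘ sym)
... | no x≢u   | yes refl = _ , _ , x∈p , z∈p , x≢z , x≢u , (y≢z ∘ sym)
... | no x≢u   | no y≢u   = _ , _ , x∈p , y∈p , x≢y , x≢u , y≢u

two-on-one-side : ∀ {n} {p : Subset n} (S : Subset n) {x y z} → x ∈ p → y ∈ p → z ∈ p →
  x ≢ y → x ≢ z → y ≢ z →
  ∃₂ λ a b → a ∈ p × b ∈ p × a ≢ b × ((a ∈ S × b ∈ S) ⊎ (a ∉ S × b ∉ S))
two-on-one-side S {x} {y} {z} x∈p y∈p z∈p x≢y x≢z y≢z with x ∈? S | y ∈? S | z ∈? S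
... | yes x∈S | yes y∈S | _       = _ , _ , x∈p , y∈p , x≢y , inj₁ (x∈S , y∈S)
... | yes x∈S | no _    | yes z∈S = _ , _ , x∈p , z∈p , x≢z , inj₁ (x∈S , z∈S)
... | yes _   | no y∉S  | no z∉S  = _ , _ , y∈p , z∈p , y≢z , inj₂ (y∉S , z∉S)
... | no _    | yes y∈S | yes z∈S = _ , _ , y∈p , z∈p , y≢z , inj₁ (y∈S , z∈S)
... | no x∉S  | yes _   | no z∉S  = _ , _ , x∈p , z∈p , x≢z , inj₂ (x∉S , z∉S)
... | no x∉S  | no y∉S  | _       = _ , _ , x∈p , y∈p , x≢y , inj₂ (x∉S , y∉S)

¬¬-minimal : ∀ {A : Set} {P : A → Set} (g : A → ℕ) {x} → P x →
  ¬ ¬ (∃ λ y → P y × ∀ z → P z → g y ≤ g z)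
¬¬-minimal {P = P} g {x} Px = below (g x) ℕ.≤-refl Px
  where
  below : ∀ k {y} → g y ≤ k → P y → ¬ ¬ (∃ λ y → P y × ∀ z → P z → g y ≤ g z)
  below zero    gy≤0 Py = pure (_ , Py , λ z _ → ℕ.≤-trans gy≤0 z≤n)
  below (suc k) {y} gy≤k Py = ¬¬-excluded-middle {A = ∃ λ z → P z × g z < g y} >>= λ where
    (yes (z , Pz , gz<gy)) → below k (ℕ.≤-pred (ℕ.≤-trans gz<gy gy≤k)) Pz
    (no ∄smaller)          → pure (y , Py , λ z Pz → ℕ.≮⇒≥ λ gz<gy → ∄smaller (z , Pz , gz<gy))

¬¬-decidable : ∀ {n} (P : Fin n → Set) → ¬ ¬ (∀ i → Dec (P i))
¬¬-decidable {zero}  P = pure λ ()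
¬¬-decidable {suc n} P =
  ¬¬-excluded-middle {A = P zero} >>= λ P0? →
  ¬¬-decidable (P ∘ suc) >>= λ Psuc? →
  pure λ where
    zero    → P0?
    (suc i) → Psuc? i

∈-tabulate⇔ : ∀ {n} (g : Fin n → Bool) {y} → y ∈ tabulate g ⇔ g y ≡ true
∈-tabulate⇔ g {y} = mk⇔
  (λ y∈ → trans (sym (lookup∘tabulate g y)) ([]=⇒lookup y∈))
  (λ gy → lookup⇒[]= y _ (trans (lookup∘tabulate g y) gy))

⌊⌋≡true⇔ : ∀ {P : Set} (d : Dec P) → ⌊ d ⌋ ≡ true ⇔ P
⌊⌋≡true⇔ (yes p) = mk⇔ (λ _ → p) (λ _ → refl)
⌊⌋≡true⇔ (no ¬p) = mk⇔ (λ ()) (λ p → contradiction p ¬p)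

∨-⌊⌋⇔ : ∀ {P : Set} b (d : Dec P) → b ∨ ⌊ d ⌋ ≡ true ⇔ (b ≡ true ⊎ P)
∨-⌊⌋⇔ true  d       = mk⇔ (λ _ → inj₁ refl) (λ _ → refl)
∨-⌊⌋⇔ false (yes p) = mk⇔ (λ _ → inj₂ p) (λ _ → refl)
∨-⌊⌋⇔ false (no ¬p) = mk⇔ (λ ()) λ where
  (inj₁ ())
  (inj₂ p) → contradiction p ¬p

module _ {n} (G : Graph n) where

  Adj-sym : ∀ {x y} → Adj G x y → Adj G y x
  Adj-sym {x} {y} xy = trans (Graph.sym G y x) xy

  Adj⇒≢ : ∀ {x y} → Adj G x y → x ≢ y
  Adj⇒≢ {x} xx refl = contradiction (trans (sym xx) (irrefl G x)) λ ()

  ∈N⇔Adj : ∀ {v x} → x ∈ N G v ⇔ Adj G v x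
  ∈N⇔Adj {v} = ∈-tabulate⇔ (adj G v)

  ∈N[]⇔ : ∀ {v x} → x ∈ N[ G ] v ⇔ (Adj G v x ⊎ x ≡ v)
  ∈N[]⇔ {v} {x} = ∨-⌊⌋⇔ (adj G v x) (x ≟ v) ⇔-∘ ∈-tabulate⇔ (λ u → adj G v u ∨ ⌊ u ≟ v ⌋)

  reach-source∈ : ∀ {X u y} → Reach G X u y → u ∈ X
  reach-source∈ (here u∈X)   = u∈X
  reach-source∈ (step p _ _) = reach-source∈ p

  reach-target∈ : ∀ {X u y} → Reach G X u y → y ∈ X
  reach-target∈ (here y∈X)     = y∈X
  reach-target∈ (step _ _ y∈X) = y∈X

  reach-mono : ∀ {X Y u y} → X ⊆ Y → Reach G X u y → Reach G Y u y
  reach-mono X⊆Y (here u∈X)       = here (X⊆Y u∈X)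
  reach-mono X⊆Y (step p wy y∈X) = step (reach-mono X⊆Y p) wy (X⊆Y y∈X)

  reach-trans : ∀ {X u y z} → Reach G X u y → Reach G X y z → Reach G X u z
  reach-trans p (here _)         = p
  reach-trans p (step q wz z∈X) = step (reach-trans p q) wz z∈X

  reach-penultimate : ∀ {X u y} → Reach G X u y → u ≢ y → ∃ λ w → w ∈ X × Adj G w y
  reach-penultimate (here _)     u≢u = contradiction refl u≢u
  reach-penultimate (step p wy _) _   = _ , reach-target∈ p , wy

  escape : ∀ {X Y u y} → Reach G X u y → u ∈ Y →
    Reach G Y u y ⊎ ∃₂ λ a b → Reach G Y u a × b ∉ Y × Adj G a b
  escape (here _) u∈Y = inj₁ (here u∈Y)
  escape {Y = Y} (step {x = y} p wy _) u∈Y with escape p u∈Y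
  ... | inj₂ edge = inj₂ edge
  ... | inj₁ q with y ∈? Y
  ...   | yes y∈Y = inj₁ (step q wy y∈Y)
  ...   | no y∉Y  = inj₂ (_ , y , q , y∉Y , wy)

  boundary-edge : Connected G → ∀ {S x s} → x ∉ S → s ∈ S →
    ∃₂ λ a b → Reach G (∁ S) x a × b ∈ S × Adj G a b
  boundary-edge conn {S} {x} {s} x∉S s∈S with escape (conn x s ∈⊤ ∈⊤) (x∉p⇒x∈∁p x∉S)
  ... | inj₁ q = contradiction s∈S (x∈∁p⇒x∉p (reach-target∈ q))
  ... | inj₂ (a , b , q , b∉∁S , ab) = a , b , q , x∉∁p⇒x∈p b∉∁S , ab

  ¬¬-component : ∀ {X r} → r ∈ X → ¬ ¬ (∃ λ C → ∀ y → y ∈ C ⇔ Reach G X r y)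
  ¬¬-component {X} {r} r∈X = ¬¬-decidable (Reach G X r) >>= λ reach? →
    pure (tabulate (λ y → ⌊ reach? y ⌋) , λ y →
      ⌊⌋≡true⇔ (reach? y) ⇔-∘ ∈-tabulate⇔ _)

module _ {n} (f : Fin n → ℕ) where

  wsum-fromℕ-≤⇔ : ∀ X Y → wsum (fromℕ ∘ f) X ℚ.≤ wsum (fromℕ ∘ f) Y ⇔ wsumℕ f X ≤ wsumℕ f Y
  wsum-fromℕ-≤⇔ X Y = mk⇔
    (λ le → fromℕ-cancel-≤ (subst₂ ℚ._≤_ (wsum-fromℕ f X) (wsum-fromℕ f Y) le))
    (λ le → subst₂ ℚ._≤_ (sym (wsum-fromℕ f X)) (sym (wsum-fromℕ f Y)) (fromℕ-mono-≤ le))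

  fromℕ-IsMinOver : ∀ {P S} → P S → (∀ T → P T → wsumℕ f S ≤ wsumℕ f T) →
    IsMinOver (fromℕ ∘ f) P (fromℕ (wsumℕ f S))
  fromℕ-IsMinOver {S = S} PS min =
    (S , PS , wsum-fromℕ f S) ,
    λ T PT → subst (ℚ._≤ wsum (fromℕ ∘ f) T) (wsum-fromℕ f S) (from (wsum-fromℕ-≤⇔ S T) (min T PT))

  touching-component-≤ : ∀ {G : Graph n} {S r a b} → IsSafe G (fromℕ ∘ f) S →
    Reach G (∁ S) r a → b ∈ S → Adj G a b →
    ¬ ¬ (∃ λ D → (∀ {x} → Reach G (∁ S) r x → x ∈ D) × wsumℕ f D ≤ wsumℕ f S)
  touching-component-≤ {G} {S} {r} {a} {b} (_ , safe) r⇝a b∈S ab =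
    ¬¬-component G (reach-source∈ G r⇝a) >>= λ (D , D⇔) →
    ¬¬-component G b∈S >>= λ (C , C⇔) →
    let D≤C = to (wsum-fromℕ-≤⇔ D C)
                (safe C D (b , b∈S , C⇔) (r , reach-source∈ G r⇝a , D⇔)
                  (b , a , from (C⇔ b) (here b∈S) , from (D⇔ a) r⇝a , Adj-sym G ab))
        C⊆S : C ⊆ S
        C⊆S y∈C = reach-target∈ G (to (C⇔ _) y∈C)
    in pure (D , (λ {x} → from (D⇔ x)) , ℕ.≤-trans D≤C (wsumℕ-mono f C⊆S))

module Counterexample {n} (G : Graph n) (v : Fin n) (conn : Connected G)
  (indep : Independent G (N G v)) (deg2 : ∀ u → u ∈ N G v → 2 ≤ deg G u)
  (H-conn : ConnectedOn G (∁ (N[ G ] v)))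
  {u₁ u₂ u₃ : Fin n} (u₁∈N : u₁ ∈ N G v) (u₂∈N : u₂ ∈ N G v) (u₃∈N : u₃ ∈ N G v)
  (u₁≢u₂ : u₁ ≢ u₂) (u₁≢u₃ : u₁ ≢ u₃) (u₂≢u₃ : u₂ ≢ u₃) where

  H : Subset n
  H = ∁ (N[ G ] v)

  v∈N[v] : v ∈ N[ G ] v
  v∈N[v] = from (∈N[]⇔ G) (inj₂ refl)

  N⊆N[v] : N G v ⊆ N[ G ] v
  N⊆N[v] x∈N = from (∈N[]⇔ G) (inj₁ (to (∈N⇔Adj G) x∈N))

  N-≢v : ∀ {x} → x ∈ N G v → x ≢ v
  N-≢v x∈N = Adj⇒≢ G (to (∈N⇔Adj G) x∈N) ∘ sym

  H-∉N[v] : ∀ {x} → x ∈ H → x ∉ N[ G ] v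
  H-∉N[v] = x∈∁p⇒x∉p

  N-≢H : ∀ {x h} → x ∈ N G v → h ∈ H → x ≢ h
  N-≢H x∈N h∈H refl = H-∉N[v] h∈H (N⊆N[v] x∈N)

  ∈H : ∀ {x} → x ∉ N G v → x ≢ v → x ∈ H
  ∈H x∉N x≢v = x∉p⇒x∈∁p λ x∈N[v] → case to (∈N[]⇔ G) x∈N[v] of λ where
    (inj₁ vx)  → x∉N (from (∈N⇔Adj G) vx)
    (inj₂ x≡v) → x≢v x≡v

  neighbour-in-H : ∀ {u} → u ∈ N G v → ∃ λ h → h ∈ H × Adj G u h
  neighbour-in-H {u} u∈N =
    let (h , h∈N[u] , h≢v) = ∃-∈-≢ (deg2 u u∈N) v
        uh = to (∈N⇔Adj G) h∈N[u]
    in h , ∈H (λ h∈N → indep u h u∈N h∈N uh) h≢v , uh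

  M : ℕ
  M = ∣ H ∣

  M-positive : 1 ≤ M
  M-positive = let (h , h∈H , _) = neighbour-in-H u₁∈N in subst (1 ≤_) (sym (x∈p⇒∣p∣≡suc∣p-x∣ h∈H)) (s≤s z≤n)

  weight : Fin n → ℕ
  weight x with x ∈? N[ G ] v
  ... | yes _ = M
  ... | no _  = 1

  w : Weight n
  w = fromℕ ∘ weight

  weight-N[v] : ∀ {x} → x ∈ N[ G ] v → weight x ≡ M
  weight-N[v] {x} x∈N[v] with x ∈? N[ G ] v
  ... | yes _     = refl
  ... | no x∉N[v] = contradiction x∈N[v] x∉N[v]

  weight-H : ∀ {x} → x ∈ H → weight x ≡ 1
  weight-H {x} x∈H with x ∈? N[ G ] v
  ... | yes x∈N[v] = contradiction x∈N[v] (H-∉N[v] x∈H)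
  ... | no _       = refl

  weight-positive : ∀ x → 1 ≤ weight x
  weight-positive x with x ∈? N[ G ] v
  ... | yes _ = M-positive
  ... | no _  = ℕ.≤-refl

  wsum-H : wsumℕ weight H ≡ M
  wsum-H = wsumℕ-ones weight weight-H

  heavy : ∀ {X x y z} → x ∈ X → y ∈ X → z ∈ X → x ≢ y → x ≢ z → y ≢ z →
    x ∈ N[ G ] v → y ∈ N[ G ] v → M + M < wsumℕ weight X
  heavy {X} {x} {y} {z} x∈X y∈X z∈X x≢y x≢z y≢z x∈N[v] y∈N[v] = begin-strict
    M + M                              <⟨ ℕ.m<m+n (M + M) (weight-positive z) ⟩
    M + M + weight z                   ≡⟨ cong (_+ weight z) (sym (cong₂ _+_ (weight-N[v] x∈N[v]) (weight-N[v] y∈N[v]))) ⟩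
    weight x + weight y + weight z     ≤⟨ wsumℕ-≥-triple weight x∈X y∈X z∈X x≢y x≢z y≢z ⟩
    wsumℕ weight X                     ∎
    where open ℕ.≤-Reasoning

  S₀ : Subset n
  S₀ = ∁ (N G v)

  v∈S₀ : v ∈ S₀
  v∈S₀ = x∉p⇒x∈∁p λ v∈N → N-≢v v∈N refl

  S₀-light : wsumℕ weight S₀ ≤ M + M
  S₀-light = begin
    wsumℕ weight S₀                        ≡⟨ wsumℕ-∈ weight v∈S₀ ⟩
    weight v + wsumℕ weight (S₀ - v)       ≤⟨ ℕ.+-mono-≤ (ℕ.≤-reflexive (weight-N[v] v∈N[v])) (wsumℕ-mono weight S₀-v⊆H) ⟩
    M + wsumℕ weight H                     ≡⟨ cong (M +_) wsum-H ⟩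
    M + M                                  ∎
    where
    open ℕ.≤-Reasoning
    S₀-v⊆H : S₀ - v ⊆ H
    S₀-v⊆H y∈ = ∈H (x∈∁p⇒x∉p (p─q⊆p S₀ ⁅ v ⁆ y∈)) (x∈p-y⇒x≢y y∈)

  outside-S₀-trivial : ∀ {a z} → Reach G (∁ S₀) a z → a ≡ z
  outside-S₀-trivial (here _) = refl
  outside-S₀-trivial (step p yz z∈) with outside-S₀-trivial p
  ... | refl = contradiction yz (indep _ _ (in-N (reach-target∈ G p)) (in-N z∈))
    where
    in-N : ∀ {x} → x ∈ ∁ S₀ → x ∈ N G v
    in-N = x∉∁p⇒x∈p ∘ x∈∁p⇒x∉p

  S₀-safe : IsSafe G w S₀
  S₀-safe = (v , v∈S₀) , λ C D C-comp D-comp CD →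
    from (wsum-fromℕ-≤⇔ weight D C) (component-bound C-comp D-comp CD)
    where
    component-bound : ∀ {C D} → IsComponent G S₀ C → IsComponent G (∁ S₀) D →
      EdgeBetween G C D → wsumℕ weight D ≤ wsumℕ weight C
    component-bound {C} {D} (r , _ , C⇔) (d , d∈ , D⇔) (x , _ , x∈C , _ , _) = begin
      wsumℕ weight D          ≤⟨ wsumℕ-mono weight D⊆⁅d⁆ ⟩
      wsumℕ weight ⁅ d ⁆      ≡⟨ wsumℕ-⁅⁆ weight d ⟩
      weight d                ≡⟨ weight-N[v] (N⊆N[v] (x∉∁p⇒x∈p (x∈∁p⇒x∉p d∈))) ⟩
      M                       ≤⟨ M≤C (x ≟ v) ⟩
      wsumℕ weight C          ∎
      where
      open ℕ.≤-Reasoning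
      D⊆⁅d⁆ : D ⊆ ⁅ d ⁆
      D⊆⁅d⁆ z∈D = subst (_∈ ⁅ d ⁆) (outside-S₀-trivial (to (D⇔ _) z∈D)) (x∈⁅x⁆ d)
      r⇝x : Reach G S₀ r x
      r⇝x = to (C⇔ x) x∈C
      M≤C : Dec (x ≡ v) → M ≤ wsumℕ weight C
      M≤C (yes refl) = subst (_≤ wsumℕ weight C) (weight-N[v] v∈N[v]) (wsumℕ-≥-single weight x∈C)
      M≤C (no x≢v)   = subst (_≤ wsumℕ weight C) wsum-H (wsumℕ-mono weight H⊆C)
        where
        x∈H : x ∈ H
        x∈H = ∈H (x∈∁p⇒x∉p (reach-target∈ G r⇝x)) x≢v
        H⊆S₀ : H ⊆ S₀
        H⊆S₀ h∈H = x∉p⇒x∈∁p λ h∈N → H-∉N[v] h∈H (N⊆N[v] h∈N)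
        H⊆C : H ⊆ C
        H⊆C {h} h∈H = from (C⇔ h) (reach-trans G r⇝x (reach-mono G H⊆S₀ (H-conn x h x∈H h∈H)))

  ⊤-connected-safe : IsConnSafe G w ⊤
  ⊤-connected-safe = ((v , ∈⊤) , λ _ _ _ (_ , d∈∁⊤ , _) _ → contradiction ∈⊤ (x∈∁p⇒x∉p d∈∁⊤)) , conn

  module _ {S} (S-safe : IsSafe G w S) (S-conn : ConnectedOn G S) (S-light : wsumℕ weight S ≤ M + M) where

    two-neighbours-inside : ∀ {a b} → a ∈ N G v → b ∈ N G v → a ≢ b → a ∈ S → b ∈ S → ⊥
    two-neighbours-inside {a} {b} a∈N b∈N a≢b a∈S b∈S =
      let (c , c∈S , cb) = reach-penultimate G (S-conn a b a∈S b∈S) a≢b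
          a≢c = λ a≡c → indep c b (subst (_∈ N G v) a≡c a∈N) b∈N cb
      in ℕ.<⇒≱ (heavy a∈S b∈S c∈S a≢b a≢c (Adj⇒≢ G cb ∘ sym) (N⊆N[v] a∈N) (N⊆N[v] b∈N)) S-light

    two-neighbours-outside : v ∉ S → ∀ {a b} → a ∈ N G v → b ∈ N G v → a ≢ b → a ∉ S → b ∉ S → ⊥
    two-neighbours-outside v∉S {a} {b} a∈N b∈N a≢b a∉S b∉S =
      let (s , s∈S) = proj₁ S-safe
          (p , q , v⇝p , q∈S , pq) = boundary-edge G conn v∉S s∈S
      in touching-component-≤ weight S-safe v⇝p q∈S pq λ (D , ⊆D , D≤S) →
         ℕ.<⇒≱ (heavy (⊆D (v⇝ a∈N a∉S)) (⊆D (v⇝ b∈N b∉S)) (⊆D (here v∈∁S)) a≢b (N-≢v a∈N) (N-≢v b∈N)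
                  (N⊆N[v] a∈N) (N⊆N[v] b∈N))
               (ℕ.≤-trans D≤S S-light)
      where
      v∈∁S : v ∈ ∁ S
      v∈∁S = x∉p⇒x∈∁p v∉S
      v⇝ : ∀ {x} → x ∈ N G v → x ∉ S → Reach G (∁ S) v x
      v⇝ x∈N x∉S = step (here v∈∁S) (to (∈N⇔Adj G) x∈N) (x∉p⇒x∈∁p x∉S)

    v-∉-impossible : ¬ (v ∉ S)
    v-∉-impossible v∉S =
      let (a , b , a∈N , b∈N , a≢b , side) = two-on-one-side S u₁∈N u₂∈N u₃∈N u₁≢u₂ u₁≢u₃ u₂≢u₃
      in case side of λ where
           (inj₁ (a∈S , b∈S)) → two-neighbours-inside a∈N b∈N a≢b a∈S b∈S
           (inj₂ (a∉S , b∉S)) → two-neighbours-outside v∉S a∈N b∈N a≢b a∉S b∉S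

    ⊆-pair-impossible : v ∈ S → ∀ {u} → u ∈ N[ G ] v → ¬ (∀ {y} → y ∈ S → y ≡ v ⊎ y ≡ u)
    ⊆-pair-impossible v∈S {u} u∈N[v] S⊆vu =
      let (a , b , a∈N , b∈N , a≢b , a≢u , b≢u) = two-avoiding u₁∈N u₂∈N u₃∈N u₁≢u₂ u₁≢u₃ u₂≢u₃ u
          (ha , ha∈H , a-ha) = neighbour-in-H a∈N
          (hb , hb∈H , b-hb) = neighbour-in-H b∈N
          a∈∁S = ∉S (N-≢v a∈N) a≢u
          a⇝ha = step (here a∈∁S) a-ha (H⊆∁S ha∈H)
          a⇝b = step (reach-trans G a⇝ha (reach-mono G H⊆∁S (H-conn ha hb ha∈H hb∈H)))
                     (Adj-sym G b-hb) (∉S (N-≢v b∈N) b≢u)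
      in touching-component-≤ weight S-safe (here a∈∁S) v∈S (Adj-sym G (to (∈N⇔Adj G) a∈N))
           λ (D , ⊆D , D≤S) →
           ℕ.<⇒≱ (heavy (⊆D (here a∈∁S)) (⊆D a⇝b) (⊆D a⇝ha) a≢b (N-≢H a∈N ha∈H) (N-≢H b∈N ha∈H)
                    (N⊆N[v] a∈N) (N⊆N[v] b∈N))
                 (ℕ.≤-trans D≤S S-light)
      where
      ∉S : ∀ {y} → y ≢ v → y ≢ u → y ∈ ∁ S
      ∉S y≢v y≢u = x∉p⇒x∈∁p λ y∈S → [ y≢v , y≢u ]′ (S⊆vu y∈S)
      H⊆∁S : H ⊆ ∁ S
      H⊆∁S h∈H = ∉S (λ { refl → H-∉N[v] h∈H v∈N[v] }) (λ { refl → H-∉N[v] h∈H u∈N[v] })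

    ⊆-pair : v ∈ S → ∀ {z} → z ∈ N G v → z ∈ S → ∀ {y} → y ∈ S → y ≡ v ⊎ y ≡ z
    ⊆-pair v∈S {z} z∈N z∈S {y} y∈S with y ≟ v | y ≟ z
    ... | yes y≡v | _       = inj₁ y≡v
    ... | no _    | yes y≡z = inj₂ y≡z
    ... | no y≢v  | no y≢z  = contradiction S-light
      (ℕ.<⇒≱ (heavy v∈S z∈S y∈S (N-≢v z∈N ∘ sym) (y≢v ∘ sym) (y≢z ∘ sym) v∈N[v] (N⊆N[v] z∈N)))

    ¬¬-⊆-pair : v ∈ S → ¬ ¬ (∃ λ u → u ∈ N[ G ] v × ∀ {y} → y ∈ S → y ≡ v ⊎ y ≡ u)
    ¬¬-⊆-pair v∈S = ¬¬-excluded-middle {A = ∃ λ x → x ∈ S × x ≢ v} >>= λ where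
      (no ∄other) → pure (v , v∈N[v] , λ {y} y∈S →
        inj₁ (decidable-stable (y ≟ v) λ y≢v → ∄other (y , y∈S , y≢v)))
      (yes (x , x∈S , x≢v)) →
        let (z , z∈S , zv) = reach-penultimate G (S-conn x v x∈S v∈S) x≢v
            z∈N = from (∈N⇔Adj G) (Adj-sym G zv)
        in pure (z , N⊆N[v] z∈N , λ {y} → ⊆-pair v∈S z∈N z∈S {y})

    light-impossible : ⊥
    light-impossible with v ∈? S
    ... | no v∉S = v-∉-impossible v∉S
    ... | yes v∈S = ¬¬-⊆-pair v∈S λ (u , u∈N[v] , S⊆vu) → ⊆-pair-impossible v∈S u∈N[v] S⊆vu

  connected-safe-heavy : ∀ {S} → IsConnSafe G w S → M + M < wsumℕ weight S
  connected-safe-heavy (S-safe , S-conn) = ℕ.≰⇒> (light-impossible S-safe S-conn)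

  s<cs : ∀ {a b} → IsSafeNumber G w a → IsConnSafeNumber G w b → a ℚ.< b
  s<cs {a} {b} (_ , a-min) ((T , T-cs , T≡b) , _) = begin-strict
    a                         ≤⟨ a-min S₀ S₀-safe ⟩
    wsum w S₀                 ≡⟨ wsum-fromℕ weight S₀ ⟩
    fromℕ (wsumℕ weight S₀)   ≤⟨ fromℕ-mono-≤ S₀-light ⟩
    fromℕ (M + M)             <⟨ fromℕ-mono-< (connected-safe-heavy T-cs) ⟩
    fromℕ (wsumℕ weight T)    ≡⟨ sym (wsum-fromℕ weight T) ⟩
    wsum w T                  ≡⟨ T≡b ⟩
    b                         ∎
    where open ℚₚ.≤-Reasoning

  ¬InGcs : ¬ InGcs G
  ¬InGcs G∈𝒢cs =
    ¬¬-minimal (wsumℕ weight) S₀-safe λ (S , S-safe , S-min) →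
    ¬¬-minimal (wsumℕ weight) ⊤-connected-safe λ (T , T-cs , T-min) →
    let s  = fromℕ-IsMinOver weight S-safe S-min
        cs = fromℕ-IsMinOver weight T-cs T-min
    in ℚₚ.<-irrefl (G∈𝒢cs w (fromℕ-positive ∘ weight-positive) _ _ s cs) (s<cs s cs)

corollary3p5 : ∀ {n} (G : Graph n) (v : Fin n) → Connected G
    → 3 ≤ deg G v
    → Independent G (N G v)
    → (∀ u → u ∈ N G v → 2 ≤ deg G u)
    → ConnectedOn G (∁ (N[ G ] v))
    → ¬ InGcs G
corollary3p5 G v conn deg3 indep deg2 H-conn =
  let (_ , _ , _ , u₁∈N , u₂∈N , u₃∈N , u₁≢u₂ , u₁≢u₃ , u₂≢u₃) = distinct-triple deg3
  in Counterexample.¬InGcs G v conn indep deg2 H-conn u₁∈N u₂∈N u₃∈N u₁≢u₂ u₁≢u₃ u₂≢u₃
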